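{- Let $H$ be an $r$-graph and let $P$ be a longest Berge path in $H$ with edges $e_1,\dots,e_t$ and key vertices $v_0,v_1,\dots,v_t$ (so $\{v_{i-1},v_i\}\subseteq e_i$). Then for $a\in\{0,t\}$: (a) for each edge $e\in E^O_a(P)$ we have $e\setminus\{v_a\}\subseteq K_a(P)$; (b) $d_H(v_a)\le\binom{|K_a(P)|}{r-1}+|E^I_a(P)|$, and equality holds if and only if $N_H(v_a)=\binom{K_a(P)}{r-1}\cup (E^I_a(P)-\{v_a\})$ and $\binom{K_a(P)}{r-1}\cap (E^I_a(P)-\{v_a\})=\emptyset$.
   Context: An $r$-graph is a simple $r$-uniform hypergraph; $d_H(v)$ is the number of edges containing $v$, and $N_H(v)=\{T: T\cup\{v\}\in E(H),\ v\notin T\}$ (a family of $(r-1)$-sets). A Berge path of length $t$ consists of $t+1$ distinct key vertices $v_0,\dots,v_t$ and $t$ distinct edges $e_1,\dots,e_t$ with $\{v_{i-1},v_i\}\subseteq e_i$; $K(P)=\{v_0,\dots,v_t\}$, $E(P)=\{e_1,\dots,e_t\}$. For $a\in[0,t]$: $E^O_a(P)=\{e\in E(H)\setminus E(P): v_a\in e\}$; $K_a(P)=\{v_i\in K(P)\setminus\{v_a\}:\ v_i\in e \text{ for some } e\in E^O_a(P)\}$; $E^I_a(P)=\{e_i\in E(P): v_a\in e_i\}$. For a family $\mathcal A$ of sets and a set $B$, $\mathcal A-B=\{X\setminus B: X\in\mathcal A\}$; $\binom{S}{m}$ denotes the family of $m$-subsets of $S$. -}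

module Defs where

open import Data.Nat using (ℕ; suc; _∸_)
open import Data.Fin using (Fin; zero; suc; inject₁; _≟_)
open import Data.Fin.Properties using (any?; all?)
open import Data.Fin.Subset using (Subset; _∈_; _∉_; _⊆_; _∪_; _─_; ⁅_⁆; ∣_∣)
open import Data.Fin.Subset.Properties using (_∈?_)
open import Data.Vec using (tabulate)
open import Data.Product using (Σ; ∃; _×_; _,_)
open import Relation.Binary.PropositionalEquality using (_≡_; _≢_)
open import Relation.Nullary using (Dec; does; ¬_; yes; no)
open import Relation.Nullary.Decidable using (_×-dec_; ¬?)
open import Function.Definitions using (Injective)

record Hypergraph (n r : ℕ) : Set where
  field
    m       : ℕ
    edge    : Fin m → Subset n
    uniform : ∀ j → ∣ edge j ∣ ≡ r
    simple  : Injective _≡_ _≡_ edge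
open Hypergraph public

-- A Berge path of length t: key vertices v_0..v_t (indexed by Fin (suc t)),
-- distinct edges e_1..e_t (e_{i+1} is indexed by i : Fin t), with
-- {v_i, v_{i+1}} ⊆ e_{i+1}.
record BergePath {n r : ℕ} (H : Hypergraph n r) (t : ℕ) : Set where
  field
    key      : Fin (suc t) → Fin n
    key-inj  : Injective _≡_ _≡_ key
    eidx     : Fin t → Fin (m H)
    eidx-inj : Injective _≡_ _≡_ eidx
    covers   : ∀ (i : Fin t) → key (inject₁ i) ∈ edge H (eidx i)
                             × key (suc i) ∈ edge H (eidx i)
open BergePath public

module _ {n r : ℕ} (H : Hypergraph n r) where

  Longest : ∀ {t} → BergePath H t → Set
  Longest {t} P = ∀ t′ → BergePath H t′ → t′ Data.Nat.≤ t

  degree : Fin n → ℕ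
  degree v = ∣ tabulate (λ j → does (v ∈? edge H j)) ∣

  Nbr : Fin n → Subset n → Set
  Nbr v T = ∃ λ j → (edge H j ≡ T ∪ ⁅ v ⁆) × (v ∉ T)

  module _ {t : ℕ} (P : BergePath H t) (a : Fin (suc t)) where

    EO : Fin (m H) → Set
    EO j = (key P a ∈ edge H j) × (∀ i → ¬ (eidx P i ≡ j))

    EO? : ∀ j → Dec (EO j)
    EO? j = (key P a ∈? edge H j) ×-dec all? (λ i → ¬? (eidx P i ≟ j))

    InK : Fin n → Set
    InK u = (∃ λ i → key P i ≡ u) × (¬ (u ≡ key P a))
          × (∃ λ j → EO j × u ∈ edge H j)

    InK? : ∀ u → Dec (InK u)
    InK? u = any? (λ i → key P i ≟ u) ×-dec (¬? (u ≟ key P a))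
             ×-dec any? (λ j → EO? j ×-dec (u ∈? edge H j))

    Kset : Subset n
    Kset = tabulate (λ u → does (InK? u))

    -- |E^I_a(P)|: number of path edges containing v_a (path edges are distinct)
    EIsize : ℕ
    EIsize = ∣ tabulate (λ i → does (key P a ∈? edge H (eidx P i))) ∣

    InBinomK : Subset n → Set
    InBinomK T = (T ⊆ Kset) × (∣ T ∣ ≡ r ∸ 1)

    InEIminus : Subset n → Set
    InEIminus T = ∃ λ i → (key P a ∈ edge H (eidx P i))
                          × (T ≡ edge H (eidx P i) ─ ⁅ key P a ⁆)

module Submission where

-- Let v = v_a be an endpoint of a longest Berge path P, k = r - 1 and
-- K = K_a(P).  If e ∋ v is an edge outside P, every vertex of e is a key
-- vertex, for otherwise P could be extended through e; so every vertex of
-- e - v is a key vertex other than v lying in an edge of E^O_a(P), i.e.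
-- e - v ⊆ K, which is (a).  The edges at v split into the |E^I_a(P)| path
-- edges and the outside edges, and e ↦ e - v embeds the outside edges into
-- the k-subsets of K (H is simple), of which there are |K| C k; this is
-- (b).  Equality holds iff this embedding is onto ("saturation"), and
-- saturation unfolds into the stated description of N_H(v).

open import Defs
open import Data.Nat using (ℕ; zero; suc; pred; _≤_; _+_; _∸_)
import Data.Nat.Properties as ℕ
open import Data.Nat.Combinatorics using (_C_; nCk+nC[k+1]≡[n+1]C[k+1])
open import Data.Bool using (true)
open import Data.Fin using (Fin; zero; suc; fromℕ; inject₁; opposite; punchOut; _↑ˡ_; _↑ʳ_; splitAt; _≟_)
open import Data.Fin.Properties using (any?; all?; injective⇒≤; punchOut-injective; suc-injective; opposite-involutive; splitAt-↑ˡ; splitAt-↑ʳ; splitAt⁻¹-↑ˡ; splitAt⁻¹-↑ʳ)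
open import Data.Fin.Subset using (Subset; inside; outside; _∈_; _∉_; _─_; _∪_; ⁅_⁆; _⊆_; ∣_∣; ⊥)
open import Data.Fin.Subset.Properties using (_∈?_; x∈⁅x⁆; drop-∷-⊆; ∉⊥; ∣⊥∣≡0; p─⊥≡p; q⊆p∪q; p─q⊆p; ∪-identityʳ)
open import Data.Vec using (_∷_; []; here; there; tabulate)
open import Data.Vec.Properties using (lookup⇒[]=; lookup∘tabulate)
open import Data.Product using (Σ; ∃; _×_; _,_; proj₁; proj₂)
open import Data.Sum using (_⊎_; inj₁; inj₂)
open import Data.Unit using (⊤; tt)
open import Data.Empty using (⊥-elim)
import Data.Empty.Irrelevant as Irrelevant
open import Relation.Binary.PropositionalEquality
open import Relation.Nullary using (¬_; yes; no; does)
open import Relation.Nullary.Decidable using (_×-dec_; ¬?; dec-true)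
open import Relation.Unary using (Decidable)
open import Function.Bundles using (_⇔_; mk⇔; Equivalence)
open import Function.Construct.Composition using (_⇔-∘_)
open import Function.Base using (_∘_)
open import Function.Definitions using (Injective)

count : ∀ {a} {P : Fin a → Set} → Decidable P → ℕ
count P? = ∣ tabulate (λ i → does (P? i)) ∣

enumerate : ∀ {a} {P : Fin a → Set} (P? : Decidable P) → Fin (count P?) → Fin a
enumerate {suc a} P? k with P? zero
enumerate {suc a} P? zero    | yes _ = zero
enumerate {suc a} P? (suc k) | yes _ = suc (enumerate (λ i → P? (suc i)) k)
enumerate {suc a} P? k       | no _  = suc (enumerate (λ i → P? (suc i)) k)

enumerate-sound : ∀ {a} {P : Fin a → Set} (P? : Decidable P) k → P (enumerate P? k)
enumerate-sound {suc a} P? k with P? zero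
enumerate-sound {suc a} P? zero    | yes p = p
enumerate-sound {suc a} P? (suc k) | yes _ = enumerate-sound (λ i → P? (suc i)) k
enumerate-sound {suc a} P? k       | no _  = enumerate-sound (λ i → P? (suc i)) k

enumerate-injective : ∀ {a} {P : Fin a → Set} (P? : Decidable P) → Injective _≡_ _≡_ (enumerate P?)
enumerate-injective {suc a} P? {k} {l} eq with P? zero
enumerate-injective {suc a} P? {zero}  {zero}  eq | yes _ = refl
enumerate-injective {suc a} P? {suc k} {suc l} eq | yes _ =
  cong suc (enumerate-injective (λ i → P? (suc i)) (suc-injective eq))
enumerate-injective {suc a} P? {k}     {l}     eq | no _ =
  enumerate-injective (λ i → P? (suc i)) (suc-injective eq)

position : ∀ {a} {P : Fin a → Set} (P? : Decidable P) i → P i → ∃ λ k → enumerate P? k ≡ i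
position {suc a} P? i p with P? zero
position {suc a} P? zero    p | yes _ = zero , refl
position {suc a} P? (suc i) p | yes _ with k , eq ← position (λ i → P? (suc i)) i p = suc k , cong suc eq
position {suc a} P? zero    p | no ¬p = ⊥-elim (¬p p)
position {suc a} P? (suc i) p | no _  with k , eq ← position (λ i → P? (suc i)) i p = k , cong suc eq

-- An injection Fin m → Fin n with n ≤ m is onto: if it missed y, then
-- x ↦ punchOut (f x) would be an injection Fin m → Fin (n - 1).
injective⇒onto : ∀ {m n} (f : Fin m → Fin n) → n ≤ m → Injective _≡_ _≡_ f → ∀ y → ∃ λ x → f x ≡ y
injective⇒onto {m} {suc n} f n<m f-inj y with any? (λ x → f x ≟ y)
... | yes hit = hit
... | no miss = ⊥-elim (ℕ.1+n≰n (ℕ.≤-trans n<m m≤n))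
  where
  y≢f : ∀ x → y ≢ f x
  y≢f x eq = miss (x , sym eq)
  m≤n : m ≤ n
  m≤n = injective⇒≤ {f = λ x → punchOut (y≢f x)}
          (λ eq → f-inj (punchOut-injective (y≢f _) (y≢f _) eq))

record Embedding {a b} (P : Fin a → Set) (Q : Fin b → Set) : Set where
  field
    map       : ∀ i → P i → Fin b
    map-sound : ∀ i p → Q (map i p)
    injective : ∀ i i′ p p′ → map i p ≡ map i′ p′ → i ≡ i′

module _ {a b} {P : Fin a → Set} {Q : Fin b → Set} (P? : Decidable P) (Q? : Decidable Q)
         (f : Embedding P Q) where
  open Embedding f

  private
    mapped : ∀ k → ∃ λ l → enumerate Q? l ≡ map (enumerate P? k) (enumerate-sound P? k)
    mapped k = position Q? _ (map-sound _ _)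

    F : Fin (count P?) → Fin (count Q?)
    F k = proj₁ (mapped k)

    F-injective : Injective _≡_ _≡_ F
    F-injective {k} {l} eq = enumerate-injective P? (injective _ _ _ _ (begin
      map (enumerate P? k) _ ≡⟨ proj₂ (mapped k) ⟨
      enumerate Q? (F k)     ≡⟨ cong (enumerate Q?) eq ⟩
      enumerate Q? (F l)     ≡⟨ proj₂ (mapped l) ⟩
      map (enumerate P? l) _ ∎))
      where open ≡-Reasoning

  count-mono : count P? ≤ count Q?
  count-mono = injective⇒≤ F-injective

  count-onto : count P? ≡ count Q? → ∀ j → Q j → ∃ λ i → Σ (P i) λ p → map i p ≡ j
  count-onto eq j q =
    let l , enum-l = position Q? j q
        k , Fk≡l   = injective⇒onto F (ℕ.≤-reflexive (sym eq)) F-injective l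
    in enumerate P? k , enumerate-sound P? k ,
       trans (sym (proj₂ (mapped k))) (trans (cong (enumerate Q?) Fk≡l) enum-l)

every? : ∀ {b} → Decidable {A = Fin b} (λ _ → ⊤)
every? _ = yes tt

count-every : ∀ b → count (every? {b}) ≡ b
count-every zero    = refl
count-every (suc b) = cong suc (count-every b)

count-split : ∀ {a} {P Q : Fin a → Set} (P? : Decidable P) (Q? : Decidable Q)
  → count P? ≡ count (λ j → P? j ×-dec ¬? (Q? j)) + count (λ j → P? j ×-dec Q? j)
count-split {zero}  P? Q? = refl
count-split {suc a} P? Q? with P? zero | Q? zero | count-split (λ i → P? (suc i)) (λ i → Q? (suc i))
... | yes _ | yes _ | ih = trans (cong suc ih) (sym (ℕ.+-suc _ _))
... | yes _ | no _  | ih = cong suc ih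
... | no _  | yes _ | ih = ih
... | no _  | no _  | ih = ih

-- Pascal's recurrence.  Unlike _C_ it unfolds so that
-- Fin (binom (suc s) (suc k)) is literally Fin (binom s k + binom s (suc k)).
binom : ℕ → ℕ → ℕ
binom zero    zero    = 1
binom zero    (suc k) = 0
binom (suc s) zero    = 1
binom (suc s) (suc k) = binom s k + binom s (suc k)

binom≡C : ∀ s k → binom s k ≡ s C k
binom≡C zero    zero    = refl
binom≡C zero    (suc k) = refl
binom≡C (suc s) zero    = refl
binom≡C (suc s) (suc k) =
  trans (cong₂ _+_ (binom≡C s k) (binom≡C s (suc k))) (nCk+nC[k+1]≡[n+1]C[k+1] s k)

inside⊈outside : ∀ {n} {T K : Subset n} → ¬ (inside ∷ T ⊆ outside ∷ K)
inside⊈outside T⊆K with T⊆K here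
... | ()

-- The code of a k-subset T of K: at an element of K, the codes of subsets
-- containing it come first (left summand), those avoiding it second.
encode : ∀ {n} (K T : Subset n) k → .(T ⊆ K) → .(∣ T ∣ ≡ k) → Fin (binom ∣ K ∣ k)
encode []            []            zero    _   _  = zero
encode []            []            (suc k) _   eq = Irrelevant.⊥-elim (ℕ.0≢1+n eq)
encode (outside ∷ K) (outside ∷ T) k       T⊆K eq = encode K T k (drop-∷-⊆ T⊆K) eq
encode (outside ∷ K) (inside ∷ T)  k       T⊆K eq = Irrelevant.⊥-elim (inside⊈outside T⊆K)
encode (inside ∷ K)  T             zero    _   _  = zero
encode (inside ∷ K)  (inside ∷ T)  (suc k) T⊆K eq =
  encode K T k (drop-∷-⊆ T⊆K) (cong pred eq) ↑ˡ binom ∣ K ∣ (suc k)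
encode (inside ∷ K)  (outside ∷ T) (suc k) T⊆K eq =
  binom ∣ K ∣ k ↑ʳ encode K T (suc k) (drop-∷-⊆ T⊆K) eq

decode : ∀ {n} (K : Subset n) k → Fin (binom ∣ K ∣ k) → Subset n
decode K             zero    c = ⊥
decode []            (suc k) ()
decode (outside ∷ K) (suc k) c = outside ∷ decode K (suc k) c
decode (inside ∷ K)  (suc k) c with splitAt (binom ∣ K ∣ k) c
... | inj₁ c′ = inside ∷ decode K k c′
... | inj₂ c′ = outside ∷ decode K (suc k) c′

decode-⊆ : ∀ {n} (K : Subset n) k c → decode K k c ⊆ K
decode-⊆ K             zero    c x∈ = ⊥-elim (∉⊥ x∈)
decode-⊆ (outside ∷ K) (suc k) c (there x∈) = there (decode-⊆ K (suc k) c x∈)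
decode-⊆ (inside ∷ K)  (suc k) c x∈ with splitAt (binom ∣ K ∣ k) c | x∈
... | inj₁ c′ | here      = here
... | inj₁ c′ | there x∈′ = there (decode-⊆ K k c′ x∈′)
... | inj₂ c′ | there x∈′ = there (decode-⊆ K (suc k) c′ x∈′)

decode-size : ∀ {n} (K : Subset n) k c → ∣ decode K k c ∣ ≡ k
decode-size {n} K      zero    c = ∣⊥∣≡0 n
decode-size (outside ∷ K) (suc k) c = decode-size K (suc k) c
decode-size (inside ∷ K)  (suc k) c with splitAt (binom ∣ K ∣ k) c
... | inj₁ c′ = cong suc (decode-size K k c′)
... | inj₂ c′ = decode-size K (suc k) c′

empty-subset : ∀ {n} (T : Subset n) → ∣ T ∣ ≡ 0 → T ≡ ⊥
empty-subset []            _  = refl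
empty-subset (outside ∷ T) eq = cong (outside ∷_) (empty-subset T eq)

decode-encode : ∀ {n} (K T : Subset n) k (T⊆K : T ⊆ K) (eq : ∣ T ∣ ≡ k) → decode K k (encode K T k T⊆K eq) ≡ T
decode-encode K T zero T⊆K eq = sym (empty-subset T eq)
decode-encode (outside ∷ K) (outside ∷ T) (suc k) T⊆K eq =
  cong (outside ∷_) (decode-encode K T (suc k) (drop-∷-⊆ T⊆K) eq)
decode-encode (outside ∷ K) (inside ∷ T)  (suc k) T⊆K eq = ⊥-elim (inside⊈outside T⊆K)
decode-encode (inside ∷ K)  (inside ∷ T)  (suc k) T⊆K eq
  rewrite splitAt-↑ˡ (binom ∣ K ∣ k) (encode K T k (drop-∷-⊆ T⊆K) (cong pred eq)) (binom ∣ K ∣ (suc k))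
  = cong (inside ∷_) (decode-encode K T k (drop-∷-⊆ T⊆K) (cong pred eq))
decode-encode (inside ∷ K)  (outside ∷ T) (suc k) T⊆K eq
  rewrite splitAt-↑ʳ (binom ∣ K ∣ k) (binom ∣ K ∣ (suc k)) (encode K T (suc k) (drop-∷-⊆ T⊆K) eq)
  = cong (outside ∷_) (decode-encode K T (suc k) (drop-∷-⊆ T⊆K) eq)

encode-decode : ∀ {n} (K : Subset n) k c (T⊆K : decode K k c ⊆ K) (eq : ∣ decode K k c ∣ ≡ k)
  → encode K (decode K k c) k T⊆K eq ≡ c
encode-decode []            zero    zero _   _  = refl
encode-decode (outside ∷ K) zero    c    T⊆K eq = encode-decode K zero c (drop-∷-⊆ T⊆K) eq
encode-decode (inside ∷ K)  zero    zero _   _  = refl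
encode-decode (outside ∷ K) (suc k) c    T⊆K eq = encode-decode K (suc k) c (drop-∷-⊆ T⊆K) eq
encode-decode (inside ∷ K)  (suc k) c    T⊆K eq with splitAt (binom ∣ K ∣ k) c in split
... | inj₁ c′ = trans (cong (_↑ˡ binom ∣ K ∣ (suc k)) (encode-decode K k c′ (drop-∷-⊆ T⊆K) (cong pred eq)))
                      (splitAt⁻¹-↑ˡ split)
... | inj₂ c′ = trans (cong (binom ∣ K ∣ k ↑ʳ_) (encode-decode K (suc k) c′ (drop-∷-⊆ T⊆K) eq))
                      (splitAt⁻¹-↑ʳ split)

encode-cong : ∀ {n} {K X Y : Subset n} {k} → X ≡ Y
  → .(X⊆K : X ⊆ K) .(∣X∣≡k : ∣ X ∣ ≡ k) .(Y⊆K : Y ⊆ K) .(∣Y∣≡k : ∣ Y ∣ ≡ k)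
  → encode K X k X⊆K ∣X∣≡k ≡ encode K Y k Y⊆K ∣Y∣≡k
encode-cong refl _ _ _ _ = refl

decode-injective : ∀ {n} (K : Subset n) k → Injective _≡_ _≡_ (decode K k)
decode-injective K k {c} {c′} eq = begin
  c                                            ≡⟨ encode-decode K k c (decode-⊆ K k c) (decode-size K k c) ⟨
  encode K (decode K k c) k _ _                ≡⟨ encode-cong eq _ _ (decode-⊆ K k c′) (decode-size K k c′) ⟩
  encode K (decode K k c′) k _ _               ≡⟨ encode-decode K k c′ (decode-⊆ K k c′) (decode-size K k c′) ⟩
  c′                                           ∎
  where open ≡-Reasoning

∈-tabulate : ∀ {n} (f : Fin n → _) x → f x ≡ true → x ∈ tabulate f
∈-tabulate f x fx = lookup⇒[]= x (tabulate f) (trans (lookup∘tabulate f x) fx)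

∉-removed : ∀ {n} (v : Fin n) (p : Subset n) → v ∉ p ─ ⁅ v ⁆
∉-removed zero    (x ∷ p) ()
∉-removed (suc v) (x ∷ p) (there v∈) = ∉-removed v p v∈

add-remove : ∀ {n} (v : Fin n) (T : Subset n) → v ∉ T → (T ∪ ⁅ v ⁆) ─ ⁅ v ⁆ ≡ T
add-remove zero    (outside ∷ T) _   = cong (outside ∷_) (trans (p─⊥≡p _) (∪-identityʳ T))
add-remove zero    (inside ∷ T)  v∉T = ⊥-elim (v∉T here)
add-remove (suc v) (outside ∷ T) v∉T = cong (outside ∷_) (add-remove v T (λ v∈ → v∉T (there v∈)))
add-remove (suc v) (inside ∷ T)  v∉T = cong (inside ∷_) (add-remove v T (λ v∈ → v∉T (there v∈)))

remove-add : ∀ {n} (v : Fin n) (p : Subset n) → v ∈ p → (p ─ ⁅ v ⁆) ∪ ⁅ v ⁆ ≡ p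
remove-add zero    (inside ∷ p) here = cong (inside ∷_) (trans (∪-identityʳ _) (p─⊥≡p p))
remove-add (suc v) (outside ∷ p) (there v∈) = cong (outside ∷_) (remove-add v p v∈)
remove-add (suc v) (inside ∷ p)  (there v∈) = cong (inside ∷_) (remove-add v p v∈)

remove-size : ∀ {n} (v : Fin n) (p : Subset n) → v ∈ p → suc ∣ p ─ ⁅ v ⁆ ∣ ≡ ∣ p ∣
remove-size zero    (inside ∷ p)  here       = cong (λ q → suc ∣ q ∣) (p─⊥≡p p)
remove-size (suc v) (outside ∷ p) (there v∈) = remove-size v p v∈
remove-size (suc v) (inside ∷ p)  (there v∈) = cong suc (remove-size v p v∈)

module _ {n r : ℕ} (H : Hypergraph n r) where

  Link : Fin n → Subset n → Set
  Link v T = ∃ λ j → v ∈ edge H j × edge H j ─ ⁅ v ⁆ ≡ T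

  nbr⇔link : ∀ v T → Nbr H v T ⇔ Link v T
  nbr⇔link v T = mk⇔
    (λ (j , e≡ , v∉T) → j , subst (v ∈_) (sym e≡) (q⊆p∪q T ⁅ v ⁆ (x∈⁅x⁆ v)) ,
                        trans (cong (_─ ⁅ v ⁆) e≡) (add-remove v T v∉T))
    (λ (j , v∈e , e-v≡T) → j , trans (sym (remove-add v _ v∈e)) (cong (_∪ ⁅ v ⁆) e-v≡T) ,
                           subst (v ∉_) e-v≡T (∉-removed v (edge H j)))

  link-injective : ∀ {v} j j′ → v ∈ edge H j → v ∈ edge H j′
    → edge H j ─ ⁅ v ⁆ ≡ edge H j′ ─ ⁅ v ⁆ → j ≡ j′
  link-injective {v} j j′ v∈e v∈e′ eq = simple H (begin
    edge H j                      ≡⟨ remove-add v _ v∈e ⟨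
    (edge H j ─ ⁅ v ⁆) ∪ ⁅ v ⁆   ≡⟨ cong (_∪ ⁅ v ⁆) eq ⟩
    (edge H j′ ─ ⁅ v ⁆) ∪ ⁅ v ⁆  ≡⟨ remove-add v _ v∈e′ ⟩
    edge H j′                     ∎)
    where open ≡-Reasoning

  link-size : ∀ {v} j → v ∈ edge H j → ∣ edge H j ─ ⁅ v ⁆ ∣ ≡ r ∸ 1
  link-size {v} j v∈e = cong (_∸ 1) (trans (remove-size v _ v∈e) (uniform H j))

opposite-inject₁ : ∀ {t} (i : Fin t) → opposite (inject₁ i) ≡ suc (opposite i)
opposite-inject₁ {suc t} zero    = refl
opposite-inject₁ {suc t} (suc i) = cong inject₁ (opposite-inject₁ i)

opposite-injective : ∀ {t} → Injective _≡_ _≡_ (opposite {t})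
opposite-injective {x = i} {j} eq =
  trans (sym (opposite-involutive i)) (trans (cong opposite eq) (opposite-involutive j))

module _ {n r : ℕ} {H : Hypergraph n r} where

  reverse : ∀ {t} → BergePath H t → BergePath H t
  reverse P = record
    { key      = λ i → key P (opposite i)
    ; key-inj  = λ eq → opposite-injective (key-inj P eq)
    ; eidx     = λ i → eidx P (opposite i)
    ; eidx-inj = λ eq → opposite-injective (eidx-inj P eq)
    ; covers   = covers′
    }
    where
    covers′ : ∀ i → key P (opposite (inject₁ i)) ∈ edge H (eidx P (opposite i))
                  × key P (opposite (suc i)) ∈ edge H (eidx P (opposite i))
    covers′ i rewrite opposite-inject₁ i = proj₂ (covers P (opposite i)) , proj₁ (covers P (opposite i))

  extend : ∀ {t} (P : BergePath H t) {u : Fin n} {j : Fin (m H)}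
    → u ∈ edge H j → key P zero ∈ edge H j
    → (∀ i → key P i ≢ u) → (∀ i → eidx P i ≢ j) → BergePath H (suc t)
  extend {t} P {u} {j} u∈e v₀∈e u-new j-new = record
    { key = key′ ; key-inj = key′-inj ; eidx = eidx′ ; eidx-inj = eidx′-inj ; covers = covers′ }
    where
    key′ : Fin (suc (suc t)) → Fin n
    key′ zero    = u
    key′ (suc i) = key P i
    key′-inj : Injective _≡_ _≡_ key′
    key′-inj {zero}  {zero}  _  = refl
    key′-inj {zero}  {suc y} eq = ⊥-elim (u-new y (sym eq))
    key′-inj {suc x} {zero}  eq = ⊥-elim (u-new x eq)
    key′-inj {suc x} {suc y} eq = cong suc (key-inj P eq)
    eidx′ : Fin (suc t) → Fin (m H)
    eidx′ zero    = j
    eidx′ (suc i) = eidx P i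
    eidx′-inj : Injective _≡_ _≡_ eidx′
    eidx′-inj {zero}  {zero}  _  = refl
    eidx′-inj {zero}  {suc y} eq = ⊥-elim (j-new y (sym eq))
    eidx′-inj {suc x} {zero}  eq = ⊥-elim (j-new x eq)
    eidx′-inj {suc x} {suc y} eq = cong suc (eidx-inj P eq)
    covers′ : ∀ i → key′ (inject₁ i) ∈ edge H (eidx′ i) × key′ (suc i) ∈ edge H (eidx′ i)
    covers′ zero    = u∈e , v₀∈e
    covers′ (suc i) = covers P i

  -- In a longest path, every vertex of an edge through v_0 outside the
  -- path is a key vertex, as otherwise `extend` would give a longer path.
  start-closed : ∀ {t} (P : BergePath H t) → Longest H P → ∀ j u
    → key P zero ∈ edge H j → (∀ i → eidx P i ≢ j) → u ∈ edge H j → ∃ λ i → key P i ≡ u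
  start-closed {t} P longest j u v₀∈e j-new u∈e with any? (λ i → key P i ≟ u)
  ... | yes found = found
  ... | no u-new  = ⊥-elim (ℕ.1+n≰n (longest (suc t) (extend P u∈e v₀∈e (λ i eq → u-new (i , eq)) j-new)))

  -- The same holds at either endpoint, by reversing the path at v_t.
  endpoint-closed : ∀ {t} (P : BergePath H t) → Longest H P → ∀ a → a ≡ zero ⊎ a ≡ fromℕ t → ∀ j u
    → key P a ∈ edge H j → (∀ i → eidx P i ≢ j) → u ∈ edge H j → ∃ λ i → key P i ≡ u
  endpoint-closed P longest _ (inj₁ refl) = start-closed P longest
  endpoint-closed P longest _ (inj₂ refl) j u vₜ∈e j-new u∈e
    with i , eq ← start-closed (reverse P) longest j u vₜ∈e (λ i → j-new (opposite i)) u∈e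
    = opposite i , eq

module EndpointDegree {n r t : ℕ} (H : Hypergraph n r) (P : BergePath H t) (longest : Longest H P)
                      (a : Fin (suc t)) (endpoint : a ≡ zero ⊎ a ≡ fromℕ t) where

  private
    v : Fin n
    v = key P a
    k : ℕ
    k = r ∸ 1
    K : Subset n
    K = Kset H P a

  outside-link⊆K : ∀ j → EO H P a j → edge H j ─ ⁅ v ⁆ ⊆ K
  outside-link⊆K j (v∈e , j-new) {u} u∈link = ∈-tabulate _ u (dec-true (InK? H P a u)
    ( endpoint-closed P longest a endpoint j u v∈e j-new u∈e
    , (λ u≡v → ∉-removed v (edge H j) (subst (_∈ edge H j ─ ⁅ v ⁆) u≡v u∈link))
    , j , (v∈e , j-new) , u∈e ))
    where
    u∈e : u ∈ edge H j
    u∈e = p─q⊆p _ _ u∈link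

  private
    PathEdgeAt : Fin (m H) → Set
    PathEdgeAt j = v ∈ edge H j × ¬ (∀ i → eidx P i ≢ j)

    pathEdgeAt? : Decidable PathEdgeAt
    pathEdgeAt? j = (v ∈? edge H j) ×-dec ¬? (all? (λ i → ¬? (eidx P i ≟ j)))

    path-index : ∀ j → ¬ (∀ i → eidx P i ≢ j) → ∃ λ i → eidx P i ≡ j
    path-index j not-new with any? (λ i → eidx P i ≟ j)
    ... | yes found = found
    ... | no ¬found = ⊥-elim (not-new (λ i eq → ¬found (i , eq)))

    edges→indices : Embedding PathEdgeAt (λ i → v ∈ edge H (eidx P i))
    edges→indices = record
      { map       = λ j p → proj₁ (path-index j (proj₂ p))
      ; map-sound = λ j p → subst (λ j → v ∈ edge H j) (sym (proj₂ (path-index j (proj₂ p)))) (proj₁ p)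
      ; injective = λ j j′ p p′ eq →
          trans (sym (proj₂ (path-index j (proj₂ p)))) (trans (cong (eidx P) eq) (proj₂ (path-index j′ (proj₂ p′))))
      }

    indices→edges : Embedding (λ i → v ∈ edge H (eidx P i)) PathEdgeAt
    indices→edges = record
      { map       = λ i _ → eidx P i
      ; map-sound = λ i v∈e → v∈e , (λ j-new → j-new i refl)
      ; injective = λ i i′ _ _ eq → eidx-inj P eq
      }

  count-path-edges : count pathEdgeAt? ≡ EIsize H P a
  count-path-edges = ℕ.≤-antisym (count-mono pathEdgeAt? (λ i → v ∈? edge H (eidx P i)) edges→indices)
                                 (count-mono (λ i → v ∈? edge H (eidx P i)) pathEdgeAt? indices→edges)

  degree-split : degree H v ≡ EIsize H P a + count (EO? H P a)
  degree-split = trans (count-split (λ j → v ∈? edge H j) (λ j → all? (λ i → ¬? (eidx P i ≟ j))))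
                       (cong (_+ count (EO? H P a)) count-path-edges)

  private
    Code : Fin (binom ∣ K ∣ k) → Set
    Code _ = ⊤

    outside→codes : Embedding (EO H P a) Code
    outside→codes = record
      { map       = λ j p → encode K (edge H j ─ ⁅ v ⁆) k (outside-link⊆K j p) (link-size H j (proj₁ p))
      ; map-sound = λ _ _ → tt
      ; injective = λ j j′ p p′ eq → link-injective H j j′ (proj₁ p) (proj₁ p′) (begin
          edge H j ─ ⁅ v ⁆                  ≡⟨ decode-encode K _ k (outside-link⊆K j p) (link-size H j (proj₁ p)) ⟨
          decode K k (encode K _ k _ _)     ≡⟨ cong (decode K k) eq ⟩
          decode K k (encode K _ k _ _)     ≡⟨ decode-encode K _ k (outside-link⊆K j′ p′) (link-size H j′ (proj₁ p′)) ⟩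
          edge H j′ ─ ⁅ v ⁆                 ∎)
      }
      where open ≡-Reasoning

  count-outside≤ : count (EO? H P a) ≤ binom ∣ K ∣ k
  count-outside≤ = subst (count (EO? H P a) ≤_) (count-every (binom ∣ K ∣ k)) (count-mono (EO? H P a) every? outside→codes)

  EI+binom≡C+EI : EIsize H P a + binom ∣ K ∣ k ≡ (∣ K ∣ C k) + EIsize H P a
  EI+binom≡C+EI = trans (cong (EIsize H P a +_) (binom≡C ∣ K ∣ k)) (ℕ.+-comm (EIsize H P a) (∣ K ∣ C k))

  degree-bound : degree H v ≤ (∣ K ∣ C k) + EIsize H P a
  degree-bound = begin
    degree H v                          ≡⟨ degree-split ⟩
    EIsize H P a + count (EO? H P a)    ≤⟨ ℕ.+-monoʳ-≤ (EIsize H P a) count-outside≤ ⟩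
    EIsize H P a + binom ∣ K ∣ k        ≡⟨ EI+binom≡C+EI ⟩
    (∣ K ∣ C k) + EIsize H P a          ∎
    where open ℕ.≤-Reasoning

  Saturated : Set
  Saturated = ∀ T → InBinomK H P a T → ∃ λ j → EO H P a j × edge H j ─ ⁅ v ⁆ ≡ T

  degree-tight⇔count-tight : degree H v ≡ (∣ K ∣ C k) + EIsize H P a ⇔ count (EO? H P a) ≡ binom ∣ K ∣ k
  degree-tight⇔count-tight = mk⇔
    (λ eq → ℕ.+-cancelˡ-≡ (EIsize H P a) _ _ (trans (sym degree-split) (trans eq (sym EI+binom≡C+EI))))
    (λ eq → trans degree-split (trans (cong (EIsize H P a +_) eq) EI+binom≡C+EI))

  count-tight⇒saturated : count (EO? H P a) ≡ binom ∣ K ∣ k → Saturated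
  count-tight⇒saturated eq T (T⊆K , ∣T∣≡k) = j , p , (begin
      edge H j ─ ⁅ v ⁆                       ≡⟨ decode-encode K _ k (outside-link⊆K j p) (link-size H j (proj₁ p)) ⟨
      decode K k (Embedding.map outside→codes j p) ≡⟨ cong (decode K k) code≡ ⟩
      decode K k (encode K T k T⊆K ∣T∣≡k)    ≡⟨ decode-encode K T k T⊆K ∣T∣≡k ⟩
      T                                      ∎)
    where
    open ≡-Reasoning
    preimage : ∃ λ j → Σ (EO H P a j) λ p → Embedding.map outside→codes j p ≡ encode K T k T⊆K ∣T∣≡k
    preimage = count-onto (EO? H P a) every? outside→codes
                 (trans eq (sym (count-every (binom ∣ K ∣ k)))) (encode K T k T⊆K ∣T∣≡k) tt
    j : Fin (m H)
    j = proj₁ preimage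
    p : EO H P a j
    p = proj₁ (proj₂ preimage)
    code≡ : Embedding.map outside→codes j p ≡ encode K T k T⊆K ∣T∣≡k
    code≡ = proj₂ (proj₂ preimage)

  saturated⇒≥ : Saturated → binom ∣ K ∣ k ≤ count (EO? H P a)
  saturated⇒≥ sat = subst (_≤ count (EO? H P a)) (count-every (binom ∣ K ∣ k)) (count-mono every? (EO? H P a) (record
      { map       = λ c _ → proj₁ (hit c)
      ; map-sound = λ c _ → proj₁ (proj₂ (hit c))
      ; injective = λ c c′ _ _ eq → decode-injective K k
          (trans (sym (proj₂ (proj₂ (hit c)))) (trans (cong (λ j → edge H j ─ ⁅ v ⁆) eq) (proj₂ (proj₂ (hit c′)))))
      }))
      where
      hit : ∀ c → ∃ λ j → EO H P a j × edge H j ─ ⁅ v ⁆ ≡ decode K k c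
      hit c = sat (decode K k c) (decode-⊆ K k c , decode-size K k c)

  degree-tight⇔saturated : degree H v ≡ (∣ K ∣ C k) + EIsize H P a ⇔ Saturated
  degree-tight⇔saturated =
    mk⇔ count-tight⇒saturated (λ sat → ℕ.≤-antisym count-outside≤ (saturated⇒≥ sat))
    ⇔-∘ degree-tight⇔count-tight

  path-link : ∀ {T j} i → eidx P i ≡ j → v ∈ edge H j → edge H j ─ ⁅ v ⁆ ≡ T → InEIminus H P a T
  path-link i refl v∈e link≡T = i , v∈e , sym link≡T

  classify-link : ∀ T → Link H v T → InBinomK H P a T ⊎ InEIminus H P a T
  classify-link T (j , v∈e , link≡T) with any? (λ i → eidx P i ≟ j)
  ... | yes (i , eq) = inj₂ (path-link i eq v∈e link≡T)
  ... | no  ¬path    = inj₁ ( subst (_⊆ K) link≡T (outside-link⊆K j (v∈e , λ i eq → ¬path (i , eq)))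
                            , subst (λ X → ∣ X ∣ ≡ k) link≡T (link-size H j v∈e))

  Description : Set
  Description = (∀ T → Nbr H v T ⇔ (InBinomK H P a T ⊎ InEIminus H P a T))
              × (∀ T → ¬ (InBinomK H P a T × InEIminus H P a T))

  -- Under saturation every member of either family is a link of v, and the
  -- two families are disjoint because H is simple.
  saturated⇒description : Saturated → Description
  saturated⇒description sat = (λ T → mk⇔ (classify-link T ∘ to (nbr⇔link H v T))
                                         (from (nbr⇔link H v T) ∘ link T))
                            , disjoint
    where
    open Equivalence
    link : ∀ T → InBinomK H P a T ⊎ InEIminus H P a T → Link H v T
    link T (inj₁ T∈binom) = let j , (v∈e , _) , link≡T = sat T T∈binom in j , v∈e , link≡T
    link T (inj₂ (i , v∈e , T≡link)) = eidx P i , v∈e , sym T≡link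

    disjoint : ∀ T → ¬ (InBinomK H P a T × InEIminus H P a T)
    disjoint T (T∈binom , i , v∈eᵢ , T≡linkᵢ) =
      let j , (v∈e , j-new) , link≡T = sat T T∈binom
      in j-new i (link-injective H (eidx P i) j v∈eᵢ v∈e (trans (sym T≡linkᵢ) (sym link≡T)))

  description⇒saturated : Description → Saturated
  description⇒saturated (description , disjoint) T T∈binom =
    let j , v∈e , link≡T = to (nbr⇔link H v T) (from (description T) (inj₁ T∈binom))
    in j , (v∈e , λ i eq → disjoint T (T∈binom , path-link i eq v∈e link≡T)) , link≡T
    where open Equivalence

corollary2p4 : ∀ {n r t : ℕ} (H : Hypergraph n r) (P : BergePath H t)
    → Longest H P
    → (a : Fin (suc t)) → (a ≡ zero ⊎ a ≡ fromℕ t)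
    → (∀ j → EO H P a j → edge H j ─ ⁅ key P a ⁆ ⊆ Kset H P a)
      × (degree H (key P a) ≤ (∣ Kset H P a ∣ C (r ∸ 1)) + EIsize H P a)
      × ((degree H (key P a) ≡ (∣ Kset H P a ∣ C (r ∸ 1)) + EIsize H P a)
          ⇔ ((∀ (T : Subset n) → Nbr H (key P a) T ⇔ (InBinomK H P a T ⊎ InEIminus H P a T))
             × (∀ (T : Subset n) → ¬ (InBinomK H P a T × InEIminus H P a T))))
corollary2p4 H P longest a endpoint =
  outside-link⊆K , degree-bound ,
  mk⇔ saturated⇒description description⇒saturated ⇔-∘ degree-tight⇔saturated
  where open EndpointDegree H P longest a endpoint
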